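{- For every set $X$ that is a proper subset of $\{\text{taco},\text{bat},\text{nested},\text{crossing},\text{ears},\text{swords},\text{david}\}$, $\mathrm{ex}(n,X)\in\Omega(n)$ as $n\to\infty$.
   Context: Let $P$ be a set of $n$ points in convex position in the plane (the vertices of a convex $n$-gon); a triangle on $P$ is a 3-element subset of $P$. For two distinct triangles $t_1,t_2$ on $P$, label each point of $t_1\cup t_2$ by the triangle(s) containing it and read the points in their cyclic order around the polygon. The pair forms exactly one of eight configurations. (i) If $t_1,t_2$ share two vertices $u,v$: "taco" if their third vertices lie on the same side of the line $uv$, "mariposa" if on opposite sides. (ii) If they share exactly one vertex $v$: read the remaining four vertices in cyclic order starting just after $v$; "bat" if the pattern is $t_1t_1t_2t_2$ or $t_2t_2t_1t_1$, "nested" if it is $t_1t_2t_2t_1$ or $t_2t_1t_1t_2$, "crossing" if it is $t_1t_2t_1t_2$ or $t_2t_1t_2t_1$. (iii) If they share no vertex, the cyclic sequence of the six labels is, up to rotation, reflection and exchanging the roles of $t_1,t_2$, one of: "ears" $AAABBB$, "swords" $AABABB$, "david" $ABABAB$. For a set $X$ of configurations, $\mathrm{ex}(n,X)$ is the maximum size of a family of triangles on $P$ in which no two triangles form a configuration belonging to $X$ (this depends only on $n$ and $X$). -}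

module Defs where

open import Data.Nat using (ℕ; _≤_)
open import Data.Bool using (Bool; true; false; _∨_; if_then_else_)
open import Data.Fin using (Fin; _≟_) renaming (_<_ to _<ᶠ_)
open import Data.List using (List; []; _∷_; _++_; drop; take; reverse; map; mapMaybe; allFin; length)
open import Data.List.Membership.Propositional using (_∈_)
open import Data.List.Relation.Unary.All using (All)
open import Data.List.Relation.Unary.Unique.Propositional using (Unique)
open import Data.Maybe using (Maybe; just; nothing)
open import Data.Product using (Σ; _×_; _,_)
open import Data.Sum using (_⊎_)
open import Relation.Nullary using (¬_; does)
open import Relation.Binary.PropositionalEquality using (_≡_; _≢_)

-- Points of the convex n-gon: Fin n, listed in cyclic order 0,1,…,n-1.
-- A triangle is stored as its vertex triple in increasing order (a < b < c);
-- this is a canonical representation of a 3-element subset of Fin n.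
Triple : ℕ → Set
Triple n = Fin n × Fin n × Fin n

IsTriangle : {n : ℕ} → Triple n → Set
IsTriangle (a , b , c) = (a <ᶠ b) × (b <ᶠ c)

_∈ᵗ_ : {n : ℕ} → Fin n → Triple n → Bool
p ∈ᵗ (a , b , c) = does (p ≟ a) ∨ does (p ≟ b) ∨ does (p ≟ c)

data Lab : Set where
  L₁ L₂ L₁₂ : Lab

lab : {n : ℕ} → Triple n → Triple n → Fin n → Maybe Lab
lab t₁ t₂ p with p ∈ᵗ t₁ | p ∈ᵗ t₂
... | true  | true  = just L₁₂
... | true  | false = just L₁
... | false | true  = just L₂
... | false | false = nothing

-- the labels of the points of t₁ ∪ t₂ read in cyclic order around the polygon
-- (starting from the point with smallest index)
labels : {n : ℕ} → Triple n → Triple n → List Lab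
labels {n} t₁ t₂ = mapMaybe (lab t₁ t₂) (allFin n)

rotate : {A : Set} → ℕ → List A → List A
rotate k w = drop k w ++ take k w

swapLab : Lab → Lab
swapLab L₁ = L₂
swapLab L₂ = L₁
swapLab L₁₂ = L₁₂

reflectIf : Bool → List Lab → List Lab
reflectIf b w = if b then reverse w else w

swapIf : Bool → List Lab → List Lab
swapIf b w = if b then map swapLab w else w

UpToSym : List Lab → List Lab → Set
UpToSym w p = Σ ℕ λ k → Σ Bool λ r → Σ Bool λ s → swapIf s (reflectIf r (rotate k w)) ≡ p

RotOf : List Lab → List Lab → Set
RotOf w p = Σ ℕ λ k → rotate k w ≡ p

data Config : Set where
  taco mariposa bat nested crossing ears swords david : Config

FormsW : Config → List Lab → Set
-- two shared vertices u,v (labels L₁₂): the third vertices lie on the same side of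
-- the chord uv iff they are not separated by u,v in the cyclic order
FormsW taco w =
  RotOf w (L₁₂ ∷ L₁₂ ∷ L₁ ∷ L₂ ∷ []) ⊎ RotOf w (L₁₂ ∷ L₁₂ ∷ L₂ ∷ L₁ ∷ [])
FormsW mariposa w =
  RotOf w (L₁₂ ∷ L₁ ∷ L₁₂ ∷ L₂ ∷ []) ⊎ RotOf w (L₁₂ ∷ L₂ ∷ L₁₂ ∷ L₁ ∷ [])
-- one shared vertex v: rotate so that v comes first, then read the other four
FormsW bat w =
  RotOf w (L₁₂ ∷ L₁ ∷ L₁ ∷ L₂ ∷ L₂ ∷ []) ⊎ RotOf w (L₁₂ ∷ L₂ ∷ L₂ ∷ L₁ ∷ L₁ ∷ [])
FormsW nested w =
  RotOf w (L₁₂ ∷ L₁ ∷ L₂ ∷ L₂ ∷ L₁ ∷ []) ⊎ RotOf w (L₁₂ ∷ L₂ ∷ L₁ ∷ L₁ ∷ L₂ ∷ [])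
FormsW crossing w =
  RotOf w (L₁₂ ∷ L₁ ∷ L₂ ∷ L₁ ∷ L₂ ∷ []) ⊎ RotOf w (L₁₂ ∷ L₂ ∷ L₁ ∷ L₂ ∷ L₁ ∷ [])
-- no shared vertex: up to rotation, reflection and exchanging t₁,t₂
FormsW ears w = UpToSym w (L₁ ∷ L₁ ∷ L₁ ∷ L₂ ∷ L₂ ∷ L₂ ∷ [])
FormsW swords w = UpToSym w (L₁ ∷ L₁ ∷ L₂ ∷ L₁ ∷ L₂ ∷ L₂ ∷ [])
FormsW david w = UpToSym w (L₁ ∷ L₂ ∷ L₁ ∷ L₂ ∷ L₁ ∷ L₂ ∷ [])

Forms : {n : ℕ} → Config → Triple n → Triple n → Set
Forms κ t₁ t₂ = FormsW κ (labels t₁ t₂)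

-- a set X of configurations is given by its characteristic function
-- F is a family of (distinct) triangles on P in which no two distinct
-- triangles form a configuration belonging to X
ValidFamily : (n : ℕ) → (Config → Bool) → List (Triple n) → Set
ValidFamily n X F =
  Unique F × All IsTriangle F ×
  (∀ t₁ t₂ → t₁ ∈ F → t₂ ∈ F → t₁ ≢ t₂ → ∀ κ → X κ ≡ true → ¬ Forms κ t₁ t₂)

IsEx : (n : ℕ) → (Config → Bool) → ℕ → Set
IsEx n X m =
  (Σ (List (Triple n)) λ F → ValidFamily n X F × length F ≡ m) ×
  (∀ F → ValidFamily n X F → length F ≤ m)

module Submission where

-- ex(n, X) grows linearly as soon as X misses one configuration κ other than
-- mariposa.  For each such κ we exhibit, on the n-gon, a family of q = ⌊n/3⌋
-- triangles any two of which form κ and nothing else; such a family is valid for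
-- every X ∌ κ, so ex(n, X) ≥ ⌊n/3⌋ ≥ n/6 once n ≥ 3.
--
-- Whether two triangles form κ depends only on the relative order of their (at most
-- six) vertices.

open import Defs
open import Data.Bool using (Bool; true; false; _∨_; T)
open import Data.Bool.Properties using (T-∨)
open import Data.Empty using (⊥-elim)
open import Data.Fin using (Fin; toℕ; fromℕ<; fromℕ)
import Data.Fin as Fin
open import Data.Fin.Properties using (toℕ-injective; toℕ-fromℕ<; toℕ-fromℕ; toℕ<n; any?)
open import Data.List using (List; []; _∷_; map; mapMaybe; catMaybes; allFin; tabulate; length; filter)
open import Data.List.Membership.Propositional using (_∈_)
open import Data.List.Membership.Propositional.Properties using (∈-filter⁺; ∈-tabulate⁻)
open import Data.List.Properties
  using (length-tabulate; map-tabulate; map-∘; mapMaybe-cong; map-cong-local; ≡-dec; drop-all; take-all)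
import Data.List.Relation.Unary.All as All
import Data.List.Relation.Unary.All.Properties as All
open import Data.List.Relation.Unary.Any using (here; there)
open import Data.List.Relation.Unary.Unique.Propositional.Properties using (tabulate⁺)
open import Data.Maybe using (Maybe; just; nothing)
open import Data.Nat using (ℕ; zero; suc; _≤_; _<_; _+_; _∸_; _*_; _≡ᵇ_; z≤n; s≤s)
import Data.Nat as ℕ
open import Data.Nat.DivMod using (_/_; _%_; m≡m%n+[m/n]*n; m%n<n; m/n*n≤m; m≥n⇒m/n>0)
open import Data.Nat.Properties
  using (≤-reflexive; ≤-refl; ≤-trans; <-trans; <-≤-trans; <-irrefl; <-cmp; ≤∧≢⇒<; <⇒≤; ≰⇒>; n≤1+n;
         m≤m+n; m<m+n; m<n⇒0<n; m<n⇒0<n∸m; m∸n≤m; ∸-monoʳ-<; ≡ᵇ⇒≡;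
         +-suc; +-identityʳ; +-assoc; *-comm; *-distribˡ-+;
         +-mono-≤; +-monoˡ-≤; +-monoʳ-<; +-monoˡ-<; *-monoˡ-≤; *-monoʳ-≤; module ≤-Reasoning)
open import Data.Product using (Σ; _×_; _,_; proj₁; proj₂)
open import Data.Sum using (_⊎_; inj₁; inj₂)
open import Data.Unit using (tt)
open import Function using (_∘_; id)
open import Function.Bundles using (Equivalence)
open import Relation.Binary.Definitions using (DecidableEquality; tri<; tri≈; tri>)
open import Relation.Binary.PropositionalEquality
  using (_≡_; _≢_; refl; sym; trans; cong; cong₂; subst; module ≡-Reasoning)
open import Relation.Nullary using (¬_; Dec; does; yes; no)
open import Relation.Nullary.Decidable using (does-≡; map′; _⊎-dec_; _×-dec_; True; toWitness)


Triℕ : Set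
Triℕ = ℕ × ℕ × ℕ

toℕ³ : {n : ℕ} → Triple n → Triℕ
toℕ³ (a , b , c) = toℕ a , toℕ b , toℕ c

_∈ℕ_ : ℕ → Triℕ → Bool
p ∈ℕ (a , b , c) = (p ≡ᵇ a) ∨ (p ≡ᵇ b) ∨ (p ≡ᵇ c)

label : Bool → Bool → Maybe Lab
label true  true  = just L₁₂
label true  false = just L₁
label false true  = just L₂
label false false = nothing

labelℕ : Triℕ → Triℕ → ℕ → Maybe Lab
labelℕ t₁ t₂ p = label (p ∈ℕ t₁) (p ∈ℕ t₂)

interval : ℕ → ℕ → List ℕ
interval s zero    = []
interval s (suc l) = s ∷ interval (suc s) l

labelsℕ : ℕ → Triℕ → Triℕ → List Lab
labelsℕ n t₁ t₂ = mapMaybe (labelℕ t₁ t₂) (interval 0 n)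

lab≡label : {n : ℕ} (t₁ t₂ : Triple n) (p : Fin n) → lab t₁ t₂ p ≡ label (p ∈ᵗ t₁) (p ∈ᵗ t₂)
lab≡label t₁ t₂ p with p ∈ᵗ t₁ | p ∈ᵗ t₂
... | true  | true  = refl
... | true  | false = refl
... | false | true  = refl
... | false | false = refl

≟-toℕ : {n : ℕ} (x y : Fin n) → does (x Fin.≟ y) ≡ (toℕ x ≡ᵇ toℕ y)
≟-toℕ x y = does-≡ (x Fin.≟ y) (map′ toℕ-injective (cong toℕ) (toℕ x ℕ.≟ toℕ y))

∈ᵗ-toℕ : {n : ℕ} (x : Fin n) (t : Triple n) → x ∈ᵗ t ≡ toℕ x ∈ℕ toℕ³ t
∈ᵗ-toℕ x (a , b , c) rewrite ≟-toℕ x a | ≟-toℕ x b | ≟-toℕ x c = refl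

tabulate-interval : ∀ n s (f : Fin n → ℕ) → (∀ i → f i ≡ s + toℕ i) → tabulate f ≡ interval s n
tabulate-interval zero    s f f≡ = refl
tabulate-interval (suc n) s f f≡ =
  cong₂ _∷_ (trans (f≡ Fin.zero) (+-identityʳ s))
            (tabulate-interval n (suc s) (λ i → f (Fin.suc i)) (λ i → trans (f≡ (Fin.suc i)) (+-suc s (toℕ i))))

map-toℕ-allFin : ∀ n → map toℕ (allFin n) ≡ interval 0 n
map-toℕ-allFin n = trans (map-tabulate id toℕ) (tabulate-interval n 0 toℕ (λ i → refl))

labels-toℕ : {n : ℕ} (t₁ t₂ : Triple n) → labels t₁ t₂ ≡ labelsℕ n (toℕ³ t₁) (toℕ³ t₂)
labels-toℕ {n} t₁ t₂ = begin
  mapMaybe (lab t₁ t₂) (allFin n)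
    ≡⟨ mapMaybe-cong lab≡labelℕ (allFin n) ⟩
  mapMaybe (labelℕ (toℕ³ t₁) (toℕ³ t₂) ∘ toℕ) (allFin n)
    ≡⟨ cong catMaybes (map-∘ (allFin n)) ⟩
  mapMaybe (labelℕ (toℕ³ t₁) (toℕ³ t₂)) (map toℕ (allFin n))
    ≡⟨ cong (mapMaybe _) (map-toℕ-allFin n) ⟩
  labelsℕ n (toℕ³ t₁) (toℕ³ t₂) ∎
  where
    open ≡-Reasoning
    lab≡labelℕ : ∀ x → lab t₁ t₂ x ≡ labelℕ (toℕ³ t₁) (toℕ³ t₂) (toℕ x)
    lab≡labelℕ x = trans (lab≡label t₁ t₂ x) (cong₂ label (∈ᵗ-toℕ x t₁) (∈ᵗ-toℕ x t₂))

-- Increasing s ps e: the entries of ps are strictly increasing and lie in [s, e).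
-- Such a list is the image of an order-embedding of the (length ps)-gon into [s, e).
data Increasing : ℕ → List ℕ → ℕ → Set where
  end : ∀ {s e} → s ≤ e → Increasing s [] e
  _∷_ : ∀ {s p ps e} → s ≤ p → Increasing (suc p) ps e → Increasing s (p ∷ ps) e

start≤end : ∀ {s ps e} → Increasing s ps e → s ≤ e
start≤end (end s≤e)    = s≤e
start≤end (s≤p ∷ inc)  = ≤-trans s≤p (≤-trans (n≤1+n _) (start≤end inc))

start≤entry : ∀ {s ps e x} → Increasing s ps e → x ∈ ps → s ≤ x
start≤entry (s≤p ∷ inc) (here refl) = s≤p
start≤entry (s≤p ∷ inc) (there x∈)  = ≤-trans s≤p (≤-trans (n≤1+n _) (start≤entry inc x∈))

raise-end : ∀ {s ps e e′} → e ≤ e′ → Increasing s ps e → Increasing s ps e′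
raise-end e≤e′ (end s≤e)   = end (≤-trans s≤e e≤e′)
raise-end e≤e′ (s≤p ∷ inc) = s≤p ∷ raise-end e≤e′ inc

module _ {A : Set} (g : ℕ → Maybe A) where

  mapMaybe-skip : ∀ x xs → g x ≡ nothing → mapMaybe g (x ∷ xs) ≡ mapMaybe g xs
  mapMaybe-skip x xs gx≡nothing rewrite gx≡nothing = refl

  mapMaybe-keep : ∀ x xs ys → mapMaybe g xs ≡ mapMaybe g ys → mapMaybe g (x ∷ xs) ≡ mapMaybe g (x ∷ ys)
  mapMaybe-keep x xs ys eq rewrite eq = refl

  off-support : ∀ {x} {ps : List ℕ} → (g x ≢ nothing → x ∈ ps) → ¬ x ∈ ps → g x ≡ nothing
  off-support {x} sup x∉ with g x
  ... | nothing = refl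
  ... | just _  = ⊥-elim (x∉ (sup λ ()))

  mapMaybe-interval : ∀ l s ps → Increasing s ps (s + l) → (∀ x → s ≤ x → g x ≢ nothing → x ∈ ps) →
                      mapMaybe g (interval s l) ≡ mapMaybe g ps
  mapMaybe-interval zero s [] _ _ = refl
  mapMaybe-interval zero s (p ∷ ps) (s≤p ∷ inc) _ =
    ⊥-elim (<-irrefl refl (≤-trans (s≤s s≤p) (≤-trans (start≤end inc) (≤-reflexive (+-identityʳ s)))))
  mapMaybe-interval (suc l) s [] (end _) sup =
    trans (mapMaybe-skip s (interval (suc s) l) (off-support (sup s ≤-refl) λ ()))
          (mapMaybe-interval l (suc s) [] (end (m≤m+n (suc s) l)) λ x s<x → sup x (≤-trans (n≤1+n s) s<x))
  mapMaybe-interval (suc l) s (p ∷ ps) (s≤p ∷ inc) sup with p ℕ.≟ s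
  ... | yes refl =
    mapMaybe-keep p (interval (suc p) l) ps (mapMaybe-interval l (suc p) ps (subst (Increasing (suc p) ps) (+-suc p l) inc) sup′)
    where
      sup′ : ∀ x → suc p ≤ x → g x ≢ nothing → x ∈ ps
      sup′ x p<x gx with sup x (≤-trans (n≤1+n p) p<x) gx
      ... | here refl = ⊥-elim (<-irrefl refl p<x)
      ... | there x∈  = x∈
  ... | no p≢s =
    trans (mapMaybe-skip s (interval (suc s) l) (off-support (sup s ≤-refl) s∉))
          (mapMaybe-interval l (suc s) (p ∷ ps) (subst (Increasing (suc s) (p ∷ ps)) (+-suc s l) (s<p ∷ inc))
                             λ x s<x → sup x (≤-trans (n≤1+n s) s<x))
    where
      s<p : suc s ≤ p
      s<p = ≤∧≢⇒< s≤p (λ s≡p → p≢s (sym s≡p))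
      s∉ : ¬ s ∈ p ∷ ps
      s∉ (here s≡p) = p≢s (sym s≡p)
      s∉ (there s∈) = <-irrefl refl (≤-trans s<p (≤-trans (n≤1+n p) (start≤entry inc s∈)))

Bnd : ℕ → Triℕ → Set
Bnd m (a , b , c) = a < m × b < m × c < m

-- the k-th entry of a list (0 when out of range)
nth : List ℕ → ℕ → ℕ
nth []       k       = 0
nth (p ∷ ps) zero    = p
nth (p ∷ ps) (suc k) = nth ps k

along : List ℕ → Triℕ → Triℕ
along ps (a , b , c) = nth ps a , nth ps b , nth ps c

nth-∈ : ∀ ps k → k < length ps → nth ps k ∈ ps
nth-∈ (p ∷ ps) zero    _         = here refl
nth-∈ (p ∷ ps) (suc k) (s≤s k<) = there (nth-∈ ps k k<)

nth-mono : ∀ {s ps e} k a → Increasing s ps e → k < a → a < length ps → nth ps k < nth ps a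
nth-mono zero    (suc a) (_ ∷ inc) _         (s≤s a<) = start≤entry inc (nth-∈ _ a a<)
nth-mono (suc k) (suc a) (_ ∷ inc) (s≤s k<a) (s≤s a<) = nth-mono k a inc k<a a<

nth-injective : ∀ {s ps e} k a → Increasing s ps e → k < length ps → a < length ps →
                nth ps k ≡ nth ps a → k ≡ a
nth-injective k a inc k< a< eq with <-cmp k a
... | tri< k<a _ _ = ⊥-elim (<-irrefl eq (nth-mono k a inc k<a a<))
... | tri≈ _ k≡a _ = k≡a
... | tri> _ _ a<k = ⊥-elim (<-irrefl (sym eq) (nth-mono a k inc a<k k<))

map-interval-suc : ∀ (f : ℕ → ℕ) s l → map f (interval (suc s) l) ≡ map (f ∘ suc) (interval s l)
map-interval-suc f s zero    = refl
map-interval-suc f s (suc l) = cong (f (suc s) ∷_) (map-interval-suc f (suc s) l)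

map-nth : ∀ ps → map (nth ps) (interval 0 (length ps)) ≡ ps
map-nth []       = refl
map-nth (p ∷ ps) = cong (p ∷_) (trans (map-interval-suc (nth (p ∷ ps)) 0 (length ps)) (map-nth ps))

interval-< : ∀ {x} s l → x ∈ interval s l → x < s + l
interval-< s (suc l) (here refl) = ≤-trans (m≤m+n (suc s) l) (≤-reflexive (sym (+-suc s l)))
interval-< s (suc l) (there x∈)  = ≤-trans (interval-< (suc s) l x∈) (≤-reflexive (sym (+-suc s l)))

∈ℕ-sound : ∀ {x} a b c → T (x ∈ℕ (a , b , c)) → x ≡ a ⊎ x ≡ b ⊎ x ≡ c
∈ℕ-sound {x} a b c x∈ with Equivalence.to T-∨ x∈
... | inj₁ x≡a = inj₁ (≡ᵇ⇒≡ x a x≡a)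
... | inj₂ x∈bc with Equivalence.to T-∨ x∈bc
...   | inj₁ x≡b = inj₂ (inj₁ (≡ᵇ⇒≡ x b x≡b))
...   | inj₂ x≡c = inj₂ (inj₂ (≡ᵇ⇒≡ x c x≡c))

label-support : ∀ u v → label u v ≢ nothing → T u ⊎ T v
label-support true  _     _  = inj₁ _
label-support false true  _  = inj₂ _
label-support false false ne = ⊥-elim (ne refl)

along-support : ∀ {x} ps t → Bnd (length ps) t → T (x ∈ℕ along ps t) → x ∈ ps
along-support {x} ps (a , b , c) (a< , b< , c<) x∈ with ∈ℕ-sound {x} (nth ps a) (nth ps b) (nth ps c) x∈
... | inj₁ refl        = nth-∈ ps a a<
... | inj₂ (inj₁ refl) = nth-∈ ps b b<
... | inj₂ (inj₂ refl) = nth-∈ ps c c<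

nth-≡ᵇ : ∀ {s ps e} k a → Increasing s ps e → k < length ps → a < length ps →
         (nth ps k ≡ᵇ nth ps a) ≡ (k ≡ᵇ a)
nth-≡ᵇ {ps = ps} k a inc k< a< =
  does-≡ (nth ps k ℕ.≟ nth ps a) (map′ (cong (nth ps)) (nth-injective k a inc k< a<) (k ℕ.≟ a))

∈ℕ-along : ∀ {s ps e} k t → Increasing s ps e → k < length ps → Bnd (length ps) t →
           nth ps k ∈ℕ along ps t ≡ k ∈ℕ t
∈ℕ-along k (a , b , c) inc k< (a< , b< , c<)
  rewrite nth-≡ᵇ k a inc k< a< | nth-≡ᵇ k b inc k< b< | nth-≡ᵇ k c inc k< c< = refl

-- Step 2: the label word is invariant under order-embeddings.
labels-embed : ∀ e ps s₁ s₂ → Increasing 0 ps e → Bnd (length ps) s₁ → Bnd (length ps) s₂ →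
               labelsℕ e (along ps s₁) (along ps s₂) ≡ labelsℕ (length ps) s₁ s₂
labels-embed e ps s₁ s₂ inc b₁ b₂ = begin
  mapMaybe G (interval 0 e)                 ≡⟨ mapMaybe-interval G e 0 ps inc support ⟩
  mapMaybe G ps                             ≡⟨ cong (mapMaybe G) (sym (map-nth ps)) ⟩
  mapMaybe G (map (nth ps) (interval 0 m))  ≡⟨ cong catMaybes (sym (map-∘ (interval 0 m))) ⟩
  mapMaybe (G ∘ nth ps) (interval 0 m)      ≡⟨ cong catMaybes (map-cong-local (All.tabulate pullback)) ⟩
  labelsℕ m s₁ s₂                           ∎
  where
    open ≡-Reasoning
    m : ℕ
    m = length ps
    G : ℕ → Maybe Lab
    G = labelℕ (along ps s₁) (along ps s₂)
    support : ∀ x → 0 ≤ x → G x ≢ nothing → x ∈ ps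
    support x _ Gx with label-support _ _ Gx
    ... | inj₁ x∈s₁ = along-support ps s₁ b₁ x∈s₁
    ... | inj₂ x∈s₂ = along-support ps s₂ b₂ x∈s₂
    pullback : ∀ {k} → k ∈ interval 0 m → G (nth ps k) ≡ labelℕ s₁ s₂ k
    pullback {k} k∈ = cong₂ label (∈ℕ-along k s₁ inc k< b₁) (∈ℕ-along k s₂ inc k< b₂)
      where
        k< : k < length ps
        k< = interval-< 0 m k∈

_≟ˡ_ : DecidableEquality Lab
L₁  ≟ˡ L₁  = yes refl
L₁  ≟ˡ L₂  = no λ ()
L₁  ≟ˡ L₁₂ = no λ ()
L₂  ≟ˡ L₁  = no λ ()
L₂  ≟ˡ L₂  = yes refl
L₂  ≟ˡ L₁₂ = no λ ()
L₁₂ ≟ˡ L₁  = no λ ()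
L₁₂ ≟ˡ L₂  = no λ ()
L₁₂ ≟ˡ L₁₂ = yes refl

rotate-long : ∀ {A : Set} k (w : List A) → length w ≤ k → rotate k w ≡ w
rotate-long k w w≤k rewrite drop-all k w w≤k | take-all k w w≤k = refl

rotation-bounded : ∀ (h : List Lab → List Lab) w p k → h (rotate k w) ≡ p →
                   Σ (Fin (suc (length w))) λ i → h (rotate (toℕ i) w) ≡ p
rotation-bounded h w p k hw≡p with k ℕ.≤? length w
... | yes k≤ = fromℕ< (s≤s k≤) , subst (λ j → h (rotate j w) ≡ p) (sym (toℕ-fromℕ< (s≤s k≤))) hw≡p
... | no  k≰ = fromℕ (length w) , (begin
  h (rotate (toℕ (fromℕ (length w))) w) ≡⟨ cong (λ j → h (rotate j w)) (toℕ-fromℕ (length w)) ⟩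
  h (rotate (length w) w)               ≡⟨ cong h (rotate-long (length w) w ≤-refl) ⟩
  h w                                   ≡⟨ cong h (sym (rotate-long k w (<⇒≤ (≰⇒> k≰)))) ⟩
  h (rotate k w)                        ≡⟨ hw≡p ⟩
  p                                     ∎)
  where open ≡-Reasoning

rotation? : ∀ (h : List Lab → List Lab) w p → Dec (Σ ℕ λ k → h (rotate k w) ≡ p)
rotation? h w p =
  map′ (λ (i , e) → toℕ i , e) (λ (k , e) → rotation-bounded h w p k e)
       (any? λ i → ≡-dec _≟ˡ_ (h (rotate (toℕ i) w)) p)

∃-Bool? : {P : Bool → Set} → Dec (P true) → Dec (P false) → Dec (Σ Bool P)
∃-Bool? {P} P-true? P-false? = map′ fromSum toSum (P-true? ⊎-dec P-false?)
  where
    fromSum : P true ⊎ P false → Σ Bool P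
    fromSum (inj₁ x) = true , x
    fromSum (inj₂ x) = false , x
    toSum : Σ Bool P → P true ⊎ P false
    toSum (true , x)  = inj₁ x
    toSum (false , x) = inj₂ x

upToSym? : ∀ w p → Dec (UpToSym w p)
upToSym? w p = map′ rotFirst symFirst
  (∃-Bool? (∃-Bool? (rot true true) (rot true false)) (∃-Bool? (rot false true) (rot false false)))
  where
    Rot : Bool → Bool → Set
    Rot r s = Σ ℕ λ k → swapIf s (reflectIf r (rotate k w)) ≡ p
    rot : ∀ r s → Dec (Rot r s)
    rot r s = rotation? (λ v → swapIf s (reflectIf r v)) w p
    rotFirst : (Σ Bool λ r → Σ Bool λ s → Rot r s) → UpToSym w p
    rotFirst (r , s , k , e) = k , r , s , e
    symFirst : UpToSym w p → Σ Bool λ r → Σ Bool λ s → Rot r s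
    symFirst (k , r , s , e) = r , s , k , e

forms? : ∀ κ w → Dec (FormsW κ w)
forms? taco     w = rotation? id w _ ⊎-dec rotation? id w _
forms? mariposa w = rotation? id w _ ⊎-dec rotation? id w _
forms? bat      w = rotation? id w _ ⊎-dec rotation? id w _
forms? nested   w = rotation? id w _ ⊎-dec rotation? id w _
forms? crossing w = rotation? id w _ ⊎-dec rotation? id w _
forms? ears     w = upToSym? w _
forms? swords   w = upToSym? w _
forms? david    w = upToSym? w _

allConfigs : List Config
allConfigs = taco ∷ mariposa ∷ bat ∷ nested ∷ crossing ∷ ears ∷ swords ∷ david ∷ []

∈-allConfigs : ∀ κ → κ ∈ allConfigs
∈-allConfigs taco     = here refl
∈-allConfigs mariposa = there (here refl)
∈-allConfigs bat      = there (there (here refl))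
∈-allConfigs nested   = there (there (there (here refl)))
∈-allConfigs crossing = there (there (there (there (here refl))))
∈-allConfigs ears     = there (there (there (there (there (here refl)))))
∈-allConfigs swords   = there (there (there (there (there (there (here refl))))))
∈-allConfigs david    = there (there (there (there (there (there (there (here refl)))))))

formed : List Lab → List Config
formed w = filter (λ κ → forms? κ w) allConfigs

forms-only : ∀ (X : Config → Bool) κ₀ w → formed w ≡ κ₀ ∷ [] → X κ₀ ≡ false →
             ∀ κ → X κ ≡ true → ¬ FormsW κ w
forms-only X κ₀ w only Xκ₀ κ Xκ κ-formed
  with subst (κ ∈_) only (∈-filter⁺ (λ κ → forms? κ w) (∈-allConfigs κ) κ-formed)
... | here refl with trans (sym Xκ) Xκ₀
... | ()

IsTriℕ : Triℕ → Set
IsTriℕ (a , b , c) = a < b × b < c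

-- boundedness is decidable, which lets blueprints check it by computation
bnd? : ∀ m t → Dec (Bnd m t)
bnd? m (a , b , c) = (a ℕ.<? m) ×-dec (b ℕ.<? m) ×-dec (c ℕ.<? m)

raise-bnd : ∀ {m m′} t → m ≤ m′ → Bnd m t → Bnd m′ t
raise-bnd t m≤m′ (a< , b< , c<) = <-≤-trans a< m≤m′ , <-≤-trans b< m≤m′ , <-≤-trans c< m≤m′

fromℕ³ : ∀ {n} t → Bnd n t → Triple n
fromℕ³ (a , b , c) (a< , b< , c<) = fromℕ< a< , fromℕ< b< , fromℕ< c<

toℕ³-fromℕ³ : ∀ {n} t (bnd : Bnd n t) → toℕ³ (fromℕ³ t bnd) ≡ t
toℕ³-fromℕ³ (a , b , c) (a< , b< , c<) rewrite toℕ-fromℕ< a< | toℕ-fromℕ< b< | toℕ-fromℕ< c< = refl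

-- Step 4.  A blueprint of κ consists of
--   * a model pair s₁, s₂ of triangles on the m-gon that forms κ and nothing else
--     (in both orders), and whose label word differs from that of s₁ with itself;
--   * for every q, members member q i (i < q), increasing triples on the 3q-gon;
--   * for all i < j < q, an increasing placement of the m-gon into the 3q-gon
--     carrying s₁ to member i and s₂ to member j.
record Blueprint (κ : Config) : Set where
  field
    m        : ℕ
    s₁ s₂    : Triℕ
    bounded  : True (bnd? m s₁ ×-dec bnd? m s₂)
    only₁₂   : formed (labelsℕ m s₁ s₂) ≡ κ ∷ []
    only₂₁   : formed (labelsℕ m s₂ s₁) ≡ κ ∷ []
    distinct : labelsℕ m s₁ s₁ ≢ labelsℕ m s₁ s₂
    member           : ℕ → ℕ → Triℕ
    member-ok        : ∀ q i → i < q → IsTriℕ (member q i) × Bnd (q + q + q) (member q i)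
    place            : ℕ → ℕ → ℕ → List ℕ
    place-length     : ∀ q i j → length (place q i j) ≡ m
    place-increasing : ∀ q i j → i < j → j < q → Increasing 0 (place q i j) (q + q + q)
    place₁           : ∀ q i j → member q i ≡ along (place q i j) s₁
    place₂           : ∀ q i j → member q j ≡ along (place q i j) s₂

-- The members of a blueprint form a valid family of q triangles on any n-gon with
-- n ≥ 3q: any two of them are an order-embedded copy of the model pair.
module Family {κ : Config} (B : Blueprint κ) {n q : ℕ} (3q≤n : q + q + q ≤ n) where
  open Blueprint B

  member-bnd : (i : Fin q) → Bnd n (member q (toℕ i))
  member-bnd i = raise-bnd _ 3q≤n (proj₂ (member-ok q (toℕ i) (toℕ<n i)))

  triangle : Fin q → Triple n
  triangle i = fromℕ³ (member q (toℕ i)) (member-bnd i)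

  family : List (Triple n)
  family = tabulate triangle

  copy-labels : ∀ (u v : Fin q) ps x y → Increasing 0 ps (q + q + q) → length ps ≡ m →
                Bnd m x → Bnd m y → member q (toℕ u) ≡ along ps x → member q (toℕ v) ≡ along ps y →
                labels (triangle u) (triangle v) ≡ labelsℕ m x y
  copy-labels u v ps x y inc refl bx by u≡ v≡ = begin
    labels (triangle u) (triangle v)
      ≡⟨ labels-toℕ (triangle u) (triangle v) ⟩
    labelsℕ n (toℕ³ (triangle u)) (toℕ³ (triangle v))
      ≡⟨ cong₂ (labelsℕ n) (toℕ³-fromℕ³ _ (member-bnd u)) (toℕ³-fromℕ³ _ (member-bnd v)) ⟩
    labelsℕ n (member q (toℕ u)) (member q (toℕ v))
      ≡⟨ cong₂ (labelsℕ n) u≡ v≡ ⟩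
    labelsℕ n (along ps x) (along ps y)
      ≡⟨ labels-embed n ps x y (raise-end 3q≤n inc) bx by ⟩
    labelsℕ (length ps) x y ∎
    where open ≡-Reasoning

  module _ (i j : Fin q) (i<j : toℕ i < toℕ j) where
    private
      ps : List ℕ
      ps = place q (toℕ i) (toℕ j)
      inc : Increasing 0 ps (q + q + q)
      inc = place-increasing q (toℕ i) (toℕ j) i<j (toℕ<n j)
      b₁ : Bnd m s₁
      b₁ = proj₁ (toWitness bounded)
      b₂ : Bnd m s₂
      b₂ = proj₂ (toWitness bounded)

    labels₁₂ : labels (triangle i) (triangle j) ≡ labelsℕ m s₁ s₂
    labels₁₂ = copy-labels i j ps s₁ s₂ inc (place-length _ _ _) b₁ b₂ (place₁ _ _ _) (place₂ _ _ _)

    labels₂₁ : labels (triangle j) (triangle i) ≡ labelsℕ m s₂ s₁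
    labels₂₁ = copy-labels j i ps s₂ s₁ inc (place-length _ _ _) b₂ b₁ (place₂ _ _ _) (place₁ _ _ _)

    labels₁₁ : labels (triangle i) (triangle i) ≡ labelsℕ m s₁ s₁
    labels₁₁ = copy-labels i i ps s₁ s₁ inc (place-length _ _ _) b₁ b₁ (place₁ _ _ _) (place₁ _ _ _)

    triangles-differ : triangle i ≢ triangle j
    triangles-differ eq = distinct (begin
      labelsℕ m s₁ s₁                  ≡⟨ sym labels₁₁ ⟩
      labels (triangle i) (triangle i) ≡⟨ cong (labels (triangle i)) eq ⟩
      labels (triangle i) (triangle j) ≡⟨ labels₁₂ ⟩
      labelsℕ m s₁ s₂                  ∎)
      where open ≡-Reasoning

  triangle-injective : ∀ {i j} → triangle i ≡ triangle j → i ≡ j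
  triangle-injective {i} {j} eq with <-cmp (toℕ i) (toℕ j)
  ... | tri< i<j _ _ = ⊥-elim (triangles-differ i j i<j eq)
  ... | tri≈ _ i≡j _ = toℕ-injective i≡j
  ... | tri> _ _ j<i = ⊥-elim (triangles-differ j i j<i (sym eq))

  family-length : length family ≡ q
  family-length = length-tabulate triangle

  family-valid : (X : Config → Bool) → X κ ≡ false → ValidFamily n X family
  family-valid X Xκ = tabulate⁺ triangle-injective , All.tabulate⁺ is-triangle , no-forbidden-pair
    where
      is-triangle : ∀ i → IsTriangle (triangle i)
      is-triangle i = subst IsTriℕ (sym (toℕ³-fromℕ³ _ (member-bnd i))) (proj₁ (member-ok q (toℕ i) (toℕ<n i)))
      pair-ok : ∀ i j → i ≢ j → ∀ κ′ → X κ′ ≡ true → ¬ Forms κ′ (triangle i) (triangle j)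
      pair-ok i j i≢j κ′ Xκ′ with <-cmp (toℕ i) (toℕ j)
      ... | tri< i<j _ _ = subst (¬_ ∘ FormsW κ′) (sym (labels₁₂ i j i<j)) (forms-only X κ _ only₁₂ Xκ κ′ Xκ′)
      ... | tri≈ _ i≡j _ = ⊥-elim (i≢j (toℕ-injective i≡j))
      ... | tri> _ _ j<i = subst (¬_ ∘ FormsW κ′) (sym (labels₂₁ j i j<i)) (forms-only X κ _ only₂₁ Xκ κ′ Xκ′)
      no-forbidden-pair : ∀ t₁ t₂ → t₁ ∈ family → t₂ ∈ family → t₁ ≢ t₂ →
                          ∀ κ′ → X κ′ ≡ true → ¬ Forms κ′ t₁ t₂
      no-forbidden-pair t₁ t₂ t₁∈ t₂∈ t₁≢t₂ with ∈-tabulate⁻ t₁∈ | ∈-tabulate⁻ t₂∈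
      ... | i , refl | j , refl = pair-ok i j λ i≡j → t₁≢t₂ (cong triangle i≡j)

below-top : ∀ {a b c B} → a < b → b < c → c < B → IsTriℕ (a , b , c) × Bnd B (a , b , c)
below-top a<b b<c c<B = (a<b , b<c) , <-trans a<b (<-trans b<c c<B) , <-trans b<c c<B , c<B

double< : ∀ {x y} → x < y → suc (x + x) < y + y
double< {x} {y} x<y = subst (_≤ y + y) (+-suc (suc x) x) (+-mono-≤ x<y x<y)

triple< : ∀ {x y} → x < y → suc (suc (x + x + x)) < y + y + y
triple< {x} {y} x<y = subst (_≤ y + y + y) 3[x+1]≡ (+-mono-≤ (+-mono-≤ x<y x<y) x<y)
  where
    3[x+1]≡ : suc x + suc x + suc x ≡ suc (suc (suc (x + x + x)))
    3[x+1]≡ rewrite +-suc x x | +-suc (x + x) x = refl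

2q+x<3q : ∀ q {x} → x < q → suc (q + x) < q + q + q
2q+x<3q q x<q = ≤-trans (s≤s (+-monoʳ-< q x<q)) (m<m+n (q + q) (m<n⇒0<n x<q))

q+1<3q : ∀ {q x} → x < q → suc q < q + q + q
q+1<3q {q} x<q = ≤-trans (s≤s (m<m+n q (m<n⇒0<n x<q))) (m<m+n (q + q) (m<n⇒0<n x<q))

-- i q (q+1): members share the chord q (q+1), third vertices on the same side
taco-blueprint : Blueprint taco
taco-blueprint = record
  { m = 4 ; s₁ = 0 , 2 , 3 ; s₂ = 1 , 2 , 3 ; bounded = tt
  ; only₁₂ = refl ; only₂₁ = refl ; distinct = λ ()
  ; member = λ q i → i , q , suc q
  ; member-ok = λ q i i<q → below-top i<q ≤-refl (q+1<3q i<q)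
  ; place = λ q i j → i ∷ j ∷ q ∷ suc q ∷ []
  ; place-length = λ _ _ _ → refl
  ; place-increasing = λ q i j i<j j<q → z≤n ∷ i<j ∷ j<q ∷ ≤-refl ∷ end (q+1<3q j<q)
  ; place₁ = λ _ _ _ → refl ; place₂ = λ _ _ _ → refl
  }

-- 2i (2i+1) 2q: members share the apex 2q, their other vertices in disjoint blocks
bat-blueprint : Blueprint bat
bat-blueprint = record
  { m = 5 ; s₁ = 0 , 1 , 4 ; s₂ = 2 , 3 , 4 ; bounded = tt
  ; only₁₂ = refl ; only₂₁ = refl ; distinct = λ ()
  ; member = λ q i → i + i , suc (i + i) , q + q
  ; member-ok = λ q i i<q → below-top ≤-refl (double< i<q) (m<m+n (q + q) (m<n⇒0<n i<q))
  ; place = λ q i j → i + i ∷ suc (i + i) ∷ j + j ∷ suc (j + j) ∷ q + q ∷ []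
  ; place-length = λ _ _ _ → refl
  ; place-increasing = λ q i j i<j j<q →
      z≤n ∷ ≤-refl ∷ double< i<j ∷ ≤-refl ∷ double< j<q ∷ end (m<m+n (q + q) (m<n⇒0<n j<q))
  ; place₁ = λ _ _ _ → refl ; place₂ = λ _ _ _ → refl
  }

-- 0 (q-i) (q+1+i): members share 0, and a larger i gives an enclosing triangle
nested-blueprint : Blueprint nested
nested-blueprint = record
  { m = 5 ; s₁ = 0 , 2 , 3 ; s₂ = 0 , 1 , 4 ; bounded = tt
  ; only₁₂ = refl ; only₂₁ = refl ; distinct = λ ()
  ; member = λ q i → 0 , q ∸ i , suc (q + i)
  ; member-ok = λ q i i<q → below-top (m<n⇒0<n∸m i<q) (s≤s (≤-trans (m∸n≤m q i) (m≤m+n q i))) (2q+x<3q q i<q)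
  ; place = λ q i j → 0 ∷ q ∸ j ∷ q ∸ i ∷ suc (q + i) ∷ suc (q + j) ∷ []
  ; place-length = λ _ _ _ → refl
  ; place-increasing = λ q i j i<j j<q →
      z≤n ∷ m<n⇒0<n∸m j<q ∷ ∸-monoʳ-< i<j (<⇒≤ j<q) ∷ s≤s (≤-trans (m∸n≤m q i) (m≤m+n q i))
      ∷ s≤s (+-monoʳ-< q i<j) ∷ end (2q+x<3q q j<q)
  ; place₁ = λ _ _ _ → refl ; place₂ = λ _ _ _ → refl
  }

-- 0 (i+1) (q+1+i): members share 0 and their other two vertices interleave
crossing-blueprint : Blueprint crossing
crossing-blueprint = record
  { m = 5 ; s₁ = 0 , 1 , 3 ; s₂ = 0 , 2 , 4 ; bounded = tt
  ; only₁₂ = refl ; only₂₁ = refl ; distinct = λ ()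
  ; member = λ q i → 0 , suc i , suc (q + i)
  ; member-ok = λ q i i<q → below-top (s≤s z≤n) (s≤s (≤-trans i<q (m≤m+n q i))) (2q+x<3q q i<q)
  ; place = λ q i j → 0 ∷ suc i ∷ suc j ∷ suc (q + i) ∷ suc (q + j) ∷ []
  ; place-length = λ _ _ _ → refl
  ; place-increasing = λ q i j i<j j<q →
      z≤n ∷ s≤s z≤n ∷ s≤s i<j ∷ s≤s (≤-trans j<q (m≤m+n q i)) ∷ s≤s (+-monoʳ-< q i<j) ∷ end (2q+x<3q q j<q)
  ; place₁ = λ _ _ _ → refl ; place₂ = λ _ _ _ → refl
  }

-- 3i (3i+1) (3i+2): pairwise disjoint blocks of three consecutive points
ears-blueprint : Blueprint ears
ears-blueprint = record
  { m = 6 ; s₁ = 0 , 1 , 2 ; s₂ = 3 , 4 , 5 ; bounded = tt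
  ; only₁₂ = refl ; only₂₁ = refl ; distinct = λ ()
  ; member = λ q i → i + i + i , suc (i + i + i) , suc (suc (i + i + i))
  ; member-ok = λ q i i<q → below-top ≤-refl ≤-refl (triple< i<q)
  ; place = λ q i j → i + i + i ∷ suc (i + i + i) ∷ suc (suc (i + i + i))
                    ∷ j + j + j ∷ suc (j + j + j) ∷ suc (suc (j + j + j)) ∷ []
  ; place-length = λ _ _ _ → refl
  ; place-increasing = λ q i j i<j j<q →
      z≤n ∷ ≤-refl ∷ ≤-refl ∷ triple< i<j ∷ ≤-refl ∷ ≤-refl ∷ end (triple< j<q)
  ; place₁ = λ _ _ _ → refl ; place₂ = λ _ _ _ → refl
  }

-- 2i (2i+1) (2q+i): two members read i i j j i j around the polygon
swords-blueprint : Blueprint swords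
swords-blueprint = record
  { m = 6 ; s₁ = 0 , 1 , 4 ; s₂ = 2 , 3 , 5 ; bounded = tt
  ; only₁₂ = refl ; only₂₁ = refl ; distinct = λ ()
  ; member = λ q i → i + i , suc (i + i) , q + q + i
  ; member-ok = λ q i i<q → below-top ≤-refl (≤-trans (double< i<q) (m≤m+n (q + q) i)) (+-monoʳ-< (q + q) i<q)
  ; place = λ q i j → i + i ∷ suc (i + i) ∷ j + j ∷ suc (j + j) ∷ q + q + i ∷ q + q + j ∷ []
  ; place-length = λ _ _ _ → refl
  ; place-increasing = λ q i j i<j j<q →
      z≤n ∷ ≤-refl ∷ double< i<j ∷ ≤-refl ∷ ≤-trans (double< j<q) (m≤m+n (q + q) i)
      ∷ +-monoʳ-< (q + q) i<j ∷ end (+-monoʳ-< (q + q) j<q)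
  ; place₁ = λ _ _ _ → refl ; place₂ = λ _ _ _ → refl
  }

-- i (q+i) (2q+i): the vertices of two members alternate
david-blueprint : Blueprint david
david-blueprint = record
  { m = 6 ; s₁ = 0 , 2 , 4 ; s₂ = 1 , 3 , 5 ; bounded = tt
  ; only₁₂ = refl ; only₂₁ = refl ; distinct = λ ()
  ; member = λ q i → i , q + i , q + q + i
  ; member-ok = λ q i i<q →
      below-top (≤-trans i<q (m≤m+n q i)) (+-monoˡ-< i (m<m+n q (m<n⇒0<n i<q))) (+-monoʳ-< (q + q) i<q)
  ; place = λ q i j → i ∷ j ∷ q + i ∷ q + j ∷ q + q + i ∷ q + q + j ∷ []
  ; place-length = λ _ _ _ → refl
  ; place-increasing = λ q i j i<j j<q →
      z≤n ∷ i<j ∷ ≤-trans j<q (m≤m+n q i) ∷ +-monoʳ-< q i<j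
      ∷ ≤-trans (+-monoʳ-< q j<q) (m≤m+n (q + q) i) ∷ +-monoʳ-< (q + q) i<j ∷ end (+-monoʳ-< (q + q) j<q)
  ; place₁ = λ _ _ _ → refl ; place₂ = λ _ _ _ → refl
  }

blueprint : ∀ κ → κ ≢ mariposa → Blueprint κ
blueprint taco     _ = taco-blueprint
blueprint mariposa κ≢mariposa = ⊥-elim (κ≢mariposa refl)
blueprint bat      _ = bat-blueprint
blueprint nested   _ = nested-blueprint
blueprint crossing _ = crossing-blueprint
blueprint ears     _ = ears-blueprint
blueprint swords   _ = swords-blueprint
blueprint david    _ = david-blueprint

3*≡ : ∀ q → 3 * q ≡ q + q + q
3*≡ q rewrite +-identityʳ q = sym (+-assoc q q q)

thirds-fit : ∀ n → n / 3 + n / 3 + n / 3 ≤ n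
thirds-fit n = subst (_≤ n) (trans (*-comm (n / 3) 3) (3*≡ (n / 3))) (m/n*n≤m n 3)

n≤6*[n/3] : ∀ n → 3 ≤ n → n ≤ 6 * (n / 3)
n≤6*[n/3] n 3≤n = begin
  n                      ≡⟨ m≡m%n+[m/n]*n n 3 ⟩
  n % 3 + q * 3          ≤⟨ +-monoˡ-≤ (q * 3) remainder≤ ⟩
  q * 3 + q * 3          ≡⟨ sym (*-distribˡ-+ q 3 3) ⟩
  q * 6                  ≡⟨ *-comm q 6 ⟩
  6 * q                  ∎
  where
    open ≤-Reasoning
    q : ℕ
    q = n / 3
    remainder≤ : n % 3 ≤ q * 3
    remainder≤ = ≤-trans (<⇒≤ (m%n<n n 3)) (*-monoˡ-≤ 3 (m≥n⇒m/n>0 3≤n))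

-- If X misses some κ ≠ mariposa, the family of ⌊n/3⌋ triangles
-- built from the blueprint of κ is X-valid, so every extremal value m satisfies
-- n ≤ 6 ⌊n/3⌋ ≤ 6 m for n ≥ 3.
theorem3 : (X : Config → Bool) → X mariposa ≡ false →
    (Σ Config λ κ → κ ≢ mariposa × X κ ≡ false) →
    Σ ℕ λ k → Σ ℕ λ N → ∀ n → N ≤ n → ∀ m → IsEx n X m → n ≤ k * m
theorem3 X _ (κ , κ≢mariposa , Xκ) = 6 , 3 , linear-bound
  where
    linear-bound : ∀ n → 3 ≤ n → ∀ m → IsEx n X m → n ≤ 6 * m
    linear-bound n 3≤n m (_ , maximal) = ≤-trans (n≤6*[n/3] n 3≤n) (*-monoʳ-≤ 6 q≤m)
      where
        open Family (blueprint κ κ≢mariposa) {n} {n / 3} (thirds-fit n)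
        q≤m : n / 3 ≤ m
        q≤m = subst (_≤ m) family-length (maximal family (family-valid X Xκ))
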